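{- For every digraph $X=(V,E)$, the Redei-Berge polynomial satisfies the reciprocity formula \[u_X(-m)=(-1)^{|V|}\,u_{\overline{X}}(m),\] as an identity of polynomials in $m$.
   Context: A digraph is a pair $X=(V,E)$ with $V$ finite and $E\subset\{(u,v)\in V\times V\mid u\ne v\}$; $n=|V|$. The complementary digraph is $\overline{X}=(V,E^c)$ where $(u,v)\in E^c$ iff $u\ne v$ and $(u,v)\notin E$. A $V$-listing is a bijection $\sigma:[n]\to V$; $\Sigma_V$ is the set of $V$-listings; $X\mathrm{Des}(\sigma)=\{1\le i\le n-1\mid(\sigma_i,\sigma_{i+1})\in E\}$. For $I\subset[n-1]$, $F_I=\sum x_{i_1}\cdots x_{i_n}$ over $1\le i_1\le\cdots\le i_n$ with $i_j<i_{j+1}$ for $j\in I$. The Redei-Berge symmetric function is $U_X=\sum_{\sigma\in\Sigma_V}F_{X\mathrm{Des}(\sigma)}$ and the Redei-Berge polynomial is $u_X(m)=U_X(1,\dots,1,0,0,\dots)$ with $m$ ones, a polynomial in $m$ (and $u_X(-m)$ denotes this polynomial evaluated at $-m$). -}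

module Defs where

open import Data.Nat using (ℕ; zero; suc; _<ᵇ_; _≤ᵇ_; _≡ᵇ_)
open import Data.Bool using (Bool; true; false; not; _∧_; _∨_; if_then_else_)
open import Data.List using (List; []; _∷_; map; concatMap)
open import Data.Vec using (Vec; []; _∷_; toList)
open import Data.Fin using (Fin; toℕ)
open import Data.Bool.ListAction using (any)
open import Data.Nat.ListAction using (sum)
import Data.List as L
open import Data.Integer using (+_)
open import Data.Rational using (ℚ; _+_; _*_; -_; 0ℚ; 1ℚ; _/_)

allFin : (k : ℕ) → List (Fin k)
allFin k = L.allFin k

allVecs : (k n : ℕ) → List (Vec (Fin k) n)
allVecs k zero    = [] ∷ []
allVecs k (suc n) = concatMap (λ v → map (λ x → x ∷ v) (allFin k)) (allVecs k n)

Digraph : ℕ → Set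
Digraph n = Fin n → Fin n → Bool

Loopless : {n : ℕ} → Digraph n → Set
Loopless {n} E = (u : Fin n) → E u u ≡ false
  where open import Relation.Binary.PropositionalEquality using (_≡_)

complement : {n : ℕ} → Digraph n → Digraph n
complement E u v = if toℕ u ≡ᵇ toℕ v then false else not (E u v)

distinct : {n : ℕ} → List (Fin n) → Bool
distinct []       = true
distinct (x ∷ xs) = not (any (λ y → toℕ x ≡ᵇ toℕ y) xs) ∧ distinct xs

-- σ : [n] → V (given as the vector (σ₁,…,σₙ)) is a V-listing iff it is a bijection,
-- i.e. (V finite of size n) iff it is injective.
isListing : {n : ℕ} → Vec (Fin n) n → Bool
isListing σ = distinct (toList σ)

-- Descent indicator list of a sequence: i-th entry is true iff (σᵢ,σᵢ₊₁) ∈ E.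
-- This encodes X Des(σ) ⊂ [n-1] as a list of n-1 booleans.
desList : {n : ℕ} → Digraph n → List (Fin n) → List Bool
desList E (x ∷ y ∷ r) = E x y ∷ desList E (y ∷ r)
desList E _           = []

XDes : {n : ℕ} → Digraph n → Vec (Fin n) n → List Bool
XDes E σ = desList E (toList σ)

admissible : List Bool → List ℕ → Bool
admissible (b ∷ bs) (x ∷ y ∷ r) = (if b then x <ᵇ y else x ≤ᵇ y) ∧ admissible bs (y ∷ r)
admissible _ _ = true

count : {A : Set} → (A → Bool) → List A → ℕ
count p []       = 0
count p (x ∷ xs) = (if p x then 1 else 0) Data.Nat.+ count p xs
  where import Data.Nat

-- F_I(1,…,1,0,0,…) with m ones: the number of sequences 1 ≤ i₁ ≤ … ≤ iₙ ≤ m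
-- with i_j < i_{j+1} for j ∈ I.  (Entries in Fin m represent the values 1..m.)
Fone : (n : ℕ) → List Bool → ℕ → ℕ
Fone n I m = count (λ s → admissible I (map toℕ (toList s))) (allVecs m n)

-- u_X(m) = U_X(1^m) = Σ_{σ ∈ Σ_V} F_{XDes(σ)}(1^m),  for m ∈ ℕ.
uX : {n : ℕ} → Digraph n → ℕ → ℕ
uX {n} E m = sum (map (λ σ → if isListing σ then Fone n (XDes E σ) m else 0) (allVecs n n))

-- Polynomials over ℚ as coefficient lists (constant term first), Horner evaluation.
Poly : Set
Poly = List ℚ

eval : Poly → ℚ → ℚ
eval []       x = 0ℚ
eval (c ∷ cs) x = c + x * eval cs x

ℕtoℚ : ℕ → ℚ
ℕtoℚ k = (+ k) / 1

signℚ : ℕ → ℚ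
signℚ zero    = 1ℚ
signℚ (suc n) = - signℚ n

Represents : {n : ℕ} → Poly → Digraph n → Set
Represents p E = (m : ℕ) → eval p (ℕtoℚ m) ≡ ℕtoℚ (uX E m)
  where open import Relation.Binary.PropositionalEquality using (_≡_)

-- Write t⁽ⁿ⁾ = t(t + 1)⋯(t + n − 1).  For a listing σ with k = |XDes σ|, F_{XDes σ}(1,…,1) with m
-- ones counts the sequences 1 ≤ i₁ ≤ … ≤ iₙ ≤ m with k prescribed strict steps, and n! times this
-- count is (m − k)⁽ⁿ⁾: bound the first entry from below, sum over it, and telescope with
-- (n + 1)·t⁽ⁿ⁾ = t⁽ⁿ⁺¹⁾ − (t − 1)⁽ⁿ⁺¹⁾.  Hence n!·u_X(x) = Σ_σ (x − k_σ)⁽ⁿ⁾ as polynomials, both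
-- sides agreeing at every natural number.  Finally (−s)⁽ⁿ⁾ = (−1)ⁿ (s − n + 1)⁽ⁿ⁾, and the
-- X̄-descents of a listing are exactly its non-X-descents, so k_σ + k̄_σ = n − 1 and the sum for X
-- at −x is (−1)ⁿ times the sum for X̄ at x.
{-# OPTIONS --safe #-}
module Submission where

open import Defs
open import Data.Nat using (ℕ)
open import Data.Rational using (ℚ; _*_; -_)
open import Relation.Binary.PropositionalEquality using (_≡_)

open import Level using (0ℓ)
open import Function using (_∘_; id)
open import Data.Bool using (Bool; true; false; not; _∧_; if_then_else_)
open import Data.Bool.Properties using (∧-conicalˡ; ∧-conicalʳ; ∨-conicalˡ; not-injective)
open import Data.Bool.ListAction using (any)
open import Data.Fin as Fin using (Fin; toℕ)
open import Data.Fin.Properties using (toℕ<n)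
open import Data.List using (List; []; _∷_; _++_; map; length; tabulate; concatMap)
open import Data.List.Properties using (map-tabulate)
open import Data.Vec using (Vec; []; _∷_; toList)
open import Data.Vec.Properties using (length-toList)
open import Data.Nat using (zero; suc; _≤_; _<_; z≤n; s≤s; _≤ᵇ_; _∸_; _!)
import Data.Nat as ℕ
import Data.Nat.Properties as ℕ
open import Data.Nat.ListAction using () renaming (sum to sumℕ)
import Data.Nat.Coprimality as Coprimality
import Data.Integer as ℤ
import Data.Integer.Properties as ℤ
open import Data.Rational using (_+_; _-_; _/_; 0ℚ; 1ℚ; 1/_; mkℚ; ↥_; ≢-nonZero)
open import Data.Rational.Properties
  using (_≟_; +-*-commutativeRing; +-0-group; normalize-coprime;
         +-identityˡ; +-identityʳ; +-inverseʳ; *-zeroˡ; *-zeroʳ; *-identityˡ; *-inverseˡ; *-assoc)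
open import Algebra.Bundles using (CommutativeRing)
open import Algebra.Properties.Group +-0-group using () renaming (x∙y⁻¹≈ε⇒x≈y to p-q≡0⇒p≡q)
import Algebra.Properties.Semiring.Sum as SemiringSum
open SemiringSum (CommutativeRing.semiring +-*-commutativeRing)
  using (sum-syntax; sum-cong-≗; *-distribˡ-sum)
module ℕΣ = SemiringSum ℕ.+-*-semiring
open import Relation.Binary.PropositionalEquality
  using (_≢_; refl; sym; trans; cong; cong₂; subst; module ≡-Reasoning)
open import Relation.Nullary.Decidable.Core using (dec⇒maybe)
open import Tactic.RingSolver using (solve-∀)
open import Tactic.RingSolver.Core.AlmostCommutativeRing
  using (AlmostCommutativeRing; fromCommutativeRing)

open ≡-Reasoning

-- Rationals and the embedding of ℕ

ℚ-ring : AlmostCommutativeRing 0ℓ 0ℓ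
ℚ-ring = fromCommutativeRing +-*-commutativeRing (λ x → dec⇒maybe (0ℚ ≟ x))

*-cancelˡ-≡ : ∀ c {a b} → c ≢ 0ℚ → c * a ≡ c * b → a ≡ b
*-cancelˡ-≡ c {a} {b} c≢0 eq = begin
  a              ≡⟨ 1/c*[c*x]≡x a ⟨
  1/ c * (c * a) ≡⟨ cong (1/ c *_) eq ⟩
  1/ c * (c * b) ≡⟨ 1/c*[c*x]≡x b ⟩
  b              ∎
  where
  instance _ = ≢-nonZero c≢0
  1/c*[c*x]≡x : ∀ x → 1/ c * (c * x) ≡ x
  1/c*[c*x]≡x x = trans (sym (*-assoc (1/ c) c x)) (trans (cong (_* x) (*-inverseˡ c)) (*-identityˡ x))

infix 8 ↑_

↑_ : ℕ → ℚ
↑_ = ℕtoℚ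

↑-mkℚ : ∀ k → ↑ k ≡ mkℚ (ℤ.+ k) 0 (Coprimality.sym (Coprimality.1-coprimeTo k))
↑-mkℚ k = normalize-coprime _

↑-suc : ∀ k → ↑ suc k ≡ 1ℚ + ↑ k
↑-suc k = sym (begin
  1ℚ + ↑ k                        ≡⟨ cong (1ℚ +_) (↑-mkℚ k) ⟩
  (ℤ.+ 1 ℤ.+ ℤ.+ k ℤ.* ℤ.+ 1) / 1 ≡⟨ cong (λ z → (ℤ.+ 1 ℤ.+ z) / 1) (ℤ.*-identityʳ (ℤ.+ k)) ⟩
  ↑ suc k                         ∎)

↑-homo-+ : ∀ a b → ↑ (a ℕ.+ b) ≡ ↑ a + ↑ b
↑-homo-+ zero    b = sym (+-identityˡ (↑ b))
↑-homo-+ (suc a) b = begin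
  ↑ suc (a ℕ.+ b)  ≡⟨ ↑-suc (a ℕ.+ b) ⟩
  1ℚ + ↑ (a ℕ.+ b) ≡⟨ cong (1ℚ +_) (↑-homo-+ a b) ⟩
  1ℚ + (↑ a + ↑ b) ≡⟨ reassociate (↑ a) (↑ b) ⟩
  (1ℚ + ↑ a) + ↑ b ≡⟨ cong (_+ ↑ b) (↑-suc a) ⟨
  ↑ suc a + ↑ b    ∎
  where
  reassociate : ∀ x y → 1ℚ + (x + y) ≡ (1ℚ + x) + y
  reassociate = solve-∀ ℚ-ring

↑-homo-* : ∀ a b → ↑ (a ℕ.* b) ≡ ↑ a * ↑ b
↑-homo-* zero    b = sym (*-zeroˡ (↑ b))
↑-homo-* (suc a) b = begin
  ↑ (b ℕ.+ a ℕ.* b) ≡⟨ ↑-homo-+ b (a ℕ.* b) ⟩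
  ↑ b + ↑ (a ℕ.* b) ≡⟨ cong (↑ b +_) (↑-homo-* a b) ⟩
  ↑ b + ↑ a * ↑ b   ≡⟨ distrib (↑ a) (↑ b) ⟩
  (1ℚ + ↑ a) * ↑ b  ≡⟨ cong (_* ↑ b) (↑-suc a) ⟨
  ↑ suc a * ↑ b     ∎
  where
  distrib : ∀ x y → y + x * y ≡ (1ℚ + x) * y
  distrib = solve-∀ ℚ-ring

↑-injective : ∀ {a b} → ↑ a ≡ ↑ b → a ≡ b
↑-injective {a} {b} eq = ℤ.+-injective (cong ↥_ (trans (sym (↑-mkℚ a)) (trans eq (↑-mkℚ b))))

↑n!≢0 : ∀ n → ↑ (n !) ≢ 0ℚ
↑n!≢0 n = ℕ.≢-nonZero⁻¹ (n !) {{ℕ._!≢0 n}} ∘ ↑-injective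

-- Finite sums

sumOver : {A : Set} → List A → (A → ℚ) → ℚ
sumOver []       f = 0ℚ
sumOver (a ∷ as) f = f a + sumOver as f

infix 5 sumOver
syntax sumOver l (λ a → e) = ∑[ a ∈ l ] e

sumOver-cong : ∀ {A : Set} {f g : A → ℚ} → (∀ a → f a ≡ g a) → ∀ l → sumOver l f ≡ sumOver l g
sumOver-cong f≗g []      = refl
sumOver-cong f≗g (a ∷ l) = cong₂ _+_ (f≗g a) (sumOver-cong f≗g l)

*-distribˡ-sumOver : ∀ {A : Set} c (f : A → ℚ) l → c * sumOver l f ≡ ∑[ a ∈ l ] c * f a
*-distribˡ-sumOver c f []      = *-zeroʳ c
*-distribˡ-sumOver c f (a ∷ l) =
  trans (distrib c (f a) (sumOver l f)) (cong (c * f a +_) (*-distribˡ-sumOver c f l))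
  where
  distrib : ∀ c x y → c * (x + y) ≡ c * x + c * y
  distrib = solve-∀ ℚ-ring

↑-sumℕ : ∀ {A : Set} (f : A → ℕ) l → ↑ sumℕ (map f l) ≡ ∑[ a ∈ l ] ↑ f a
↑-sumℕ f []      = refl
↑-sumℕ f (a ∷ l) = trans (↑-homo-+ (f a) _) (cong (↑ f a +_) (↑-sumℕ f l))

↑-∑ : ∀ {m} (f : Fin m → ℕ) → ↑ ℕΣ.sum f ≡ ∑[ i < m ] (↑ f i)
↑-∑ {zero}  f = refl
↑-∑ {suc m} f = trans (↑-homo-+ (f Fin.zero) _) (cong (↑ f Fin.zero +_) (↑-∑ (f ∘ Fin.suc)))

suc-≤ᵇ-suc : ∀ m n → (suc m ≤ᵇ suc n) ≡ (m ≤ᵇ n)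
suc-≤ᵇ-suc zero    n = refl
suc-≤ᵇ-suc (suc m) n = refl

telescope : ∀ (G : ℕ → ℚ) {lo m} → lo ≤ m →
  ∑[ i < m ] (if lo ≤ᵇ toℕ i then G (toℕ i) - G (suc (toℕ i)) else 0ℚ) ≡ G lo - G m
telescope G {zero}   {zero}  _ = sym (+-inverseʳ (G 0))
telescope G {zero}   {suc m} _ = begin
  (G 0 - G 1) + ∑[ i < m ] (G (suc (toℕ i)) - G (suc (suc (toℕ i))))
    ≡⟨ cong ((G 0 - G 1) +_) (telescope (G ∘ suc) z≤n) ⟩
  (G 0 - G 1) + (G 1 - G (suc m))
    ≡⟨ collapse (G 0) (G 1) (G (suc m)) ⟩
  G 0 - G (suc m)
    ∎
  where
  collapse : ∀ a b c → (a - b) + (b - c) ≡ a - c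
  collapse = solve-∀ ℚ-ring
telescope G {suc lo} {suc m} (s≤s lo≤m) = begin
  0ℚ + ∑[ i < m ] (if suc lo ≤ᵇ suc (toℕ i) then Δ i else 0ℚ)
    ≡⟨ +-identityˡ _ ⟩
  ∑[ i < m ] (if suc lo ≤ᵇ suc (toℕ i) then Δ i else 0ℚ)
    ≡⟨ sum-cong-≗ {m} (λ i → cong (if_then Δ i else 0ℚ) (suc-≤ᵇ-suc lo (toℕ i))) ⟩
  ∑[ i < m ] (if lo ≤ᵇ toℕ i then Δ i else 0ℚ)
    ≡⟨ telescope (G ∘ suc) lo≤m ⟩
  G (suc lo) - G (suc m)
    ∎
  where
  Δ : Fin m → ℚ
  Δ i = G (suc (toℕ i)) - G (suc (suc (toℕ i)))

-- Polynomials

infixl 6 _+ₚ_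
infixr 7 _·ₚ_

_+ₚ_ : Poly → Poly → Poly
[]      +ₚ r       = r
(a ∷ p) +ₚ []      = a ∷ p
(a ∷ p) +ₚ (b ∷ r) = (a + b) ∷ (p +ₚ r)

_·ₚ_ : ℚ → Poly → Poly
c ·ₚ p = map (c *_) p

sumₚ : {A : Set} → List A → (A → Poly) → Poly
sumₚ []       f = []
sumₚ (a ∷ as) f = f a +ₚ sumₚ as f

infix 5 sumₚ
syntax sumₚ l (λ a → e) = ∑ₚ[ a ∈ l ] e

eval-+ₚ : ∀ p r x → eval (p +ₚ r) x ≡ eval p x + eval r x
eval-+ₚ []      r       x = sym (+-identityˡ (eval r x))
eval-+ₚ (a ∷ p) []      x = sym (+-identityʳ (eval (a ∷ p) x))
eval-+ₚ (a ∷ p) (b ∷ r) x = begin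
  (a + b) + x * eval (p +ₚ r) x           ≡⟨ cong (λ t → (a + b) + x * t) (eval-+ₚ p r x) ⟩
  (a + b) + x * (eval p x + eval r x)     ≡⟨ regroup a b x (eval p x) (eval r x) ⟩
  (a + x * eval p x) + (b + x * eval r x) ∎
  where
  regroup : ∀ a b x u v → (a + b) + x * (u + v) ≡ (a + x * u) + (b + x * v)
  regroup = solve-∀ ℚ-ring

eval-·ₚ : ∀ c p x → eval (c ·ₚ p) x ≡ c * eval p x
eval-·ₚ c []      x = sym (*-zeroʳ c)
eval-·ₚ c (a ∷ p) x = begin
  c * a + x * eval (c ·ₚ p) x ≡⟨ cong (λ t → c * a + x * t) (eval-·ₚ c p x) ⟩
  c * a + x * (c * eval p x)  ≡⟨ factor c a x (eval p x) ⟩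
  c * (a + x * eval p x)      ∎
  where
  factor : ∀ c a x u → c * a + x * (c * u) ≡ c * (a + x * u)
  factor = solve-∀ ℚ-ring

eval-sumₚ : ∀ {A : Set} (f : A → Poly) l x → eval (sumₚ l f) x ≡ ∑[ a ∈ l ] eval (f a) x
eval-sumₚ f []      x = refl
eval-sumₚ f (a ∷ l) x = trans (eval-+ₚ (f a) (sumₚ l f) x) (cong (eval (f a) x +_) (eval-sumₚ f l x))

-- The coefficients of the quotient of p by X − a are the partial Horner sums of p at a.
syntheticDiv : Poly → ℚ → Poly
syntheticDiv []           a = []
syntheticDiv (c ∷ [])     a = []
syntheticDiv (c ∷ d ∷ ds) a = eval (d ∷ ds) a ∷ syntheticDiv (d ∷ ds) a

length-syntheticDiv : ∀ c cs a → length (syntheticDiv (c ∷ cs) a) ≡ length cs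
length-syntheticDiv c []       a = refl
length-syntheticDiv c (d ∷ ds) a = cong suc (length-syntheticDiv d ds a)

eval-syntheticDiv : ∀ p a x → eval p x ≡ (x - a) * eval (syntheticDiv p a) x + eval p a
eval-syntheticDiv []           a x = zero-poly x a
  where
  zero-poly : ∀ x a → 0ℚ ≡ (x - a) * 0ℚ + 0ℚ
  zero-poly = solve-∀ ℚ-ring
eval-syntheticDiv (c ∷ [])     a x = constant c x a
  where
  constant : ∀ c x a → c + x * 0ℚ ≡ (x - a) * 0ℚ + (c + a * 0ℚ)
  constant = solve-∀ ℚ-ring
eval-syntheticDiv (c ∷ d ∷ ds) a x = begin
  c + x * eval (d ∷ ds) x             ≡⟨ cong (λ t → c + x * t) (eval-syntheticDiv (d ∷ ds) a x) ⟩
  c + x * ((x - a) * Q + B)           ≡⟨ horner c x a Q B ⟩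
  (x - a) * (B + x * Q) + (c + a * B) ∎
  where
  Q = eval (syntheticDiv (d ∷ ds) a) x
  B = eval (d ∷ ds) a
  horner : ∀ c x a Q B → c + x * ((x - a) * Q + B) ≡ (x - a) * (B + x * Q) + (c + a * B)
  horner = solve-∀ ℚ-ring

vanishes-on-ℕ≥⇒vanishes : ∀ p k → (∀ m → k ≤ m → eval p (↑ m) ≡ 0ℚ) → ∀ x → eval p x ≡ 0ℚ
vanishes-on-ℕ≥⇒vanishes p = go (length p) p refl
  where
  go : ∀ d p → length p ≡ d → ∀ k → (∀ m → k ≤ m → eval p (↑ m) ≡ 0ℚ) → ∀ x → eval p x ≡ 0ℚ
  go d       []         _   _ _    _ = refl
  go (suc d) p@(c ∷ cs) len k root x = begin
    eval p x                            ≡⟨ eval-syntheticDiv p (↑ k) x ⟩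
    (x - ↑ k) * eval Q x + eval p (↑ k) ≡⟨ cong₂ (λ u v → (x - ↑ k) * u + v) (go d Q lenQ (suc k) rootQ x) p[k]≡0 ⟩
    (x - ↑ k) * 0ℚ + 0ℚ                 ≡⟨ annihilate x (↑ k) ⟩
    0ℚ                                  ∎
    where
    Q = syntheticDiv p (↑ k)
    p[k]≡0 : eval p (↑ k) ≡ 0ℚ
    p[k]≡0 = root k ℕ.≤-refl
    lenQ : length Q ≡ d
    lenQ = trans (length-syntheticDiv c cs (↑ k)) (ℕ.suc-injective len)
    annihilate : ∀ x a → (x - a) * 0ℚ + 0ℚ ≡ 0ℚ
    annihilate = solve-∀ ℚ-ring
    rootQ : ∀ m → suc k ≤ m → eval Q (↑ m) ≡ 0ℚ
    rootQ m k<m = *-cancelˡ-≡ (↑ m - ↑ k) (ℕ.<⇒≢ k<m ∘ sym ∘ ↑-injective ∘ p-q≡0⇒p≡q _ _) (begin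
      (↑ m - ↑ k) * eval Q (↑ m)                ≡⟨ +-identityʳ ((↑ m - ↑ k) * eval Q (↑ m)) ⟨
      (↑ m - ↑ k) * eval Q (↑ m) + 0ℚ           ≡⟨ cong ((↑ m - ↑ k) * eval Q (↑ m) +_) p[k]≡0 ⟨
      (↑ m - ↑ k) * eval Q (↑ m) + eval p (↑ k) ≡⟨ eval-syntheticDiv p (↑ k) (↑ m) ⟨
      eval p (↑ m)                              ≡⟨ root m (ℕ.<⇒≤ k<m) ⟩
      0ℚ                                        ≡⟨ *-zeroʳ (↑ m - ↑ k) ⟨
      (↑ m - ↑ k) * 0ℚ                          ∎)

agree-on-ℕ⇒agree : ∀ p r → (∀ m → eval p (↑ m) ≡ eval r (↑ m)) → ∀ x → eval p x ≡ eval r x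
agree-on-ℕ⇒agree p r agree x = p-q≡0⇒p≡q _ _ (trans (sym (eval-difference x)) (vanishes-on-ℕ≥⇒vanishes d 0 root x))
  where
  d = p +ₚ (- 1ℚ) ·ₚ r
  eval-difference : ∀ y → eval d y ≡ eval p y - eval r y
  eval-difference y = begin
    eval d y                        ≡⟨ eval-+ₚ p ((- 1ℚ) ·ₚ r) y ⟩
    eval p y + eval ((- 1ℚ) ·ₚ r) y ≡⟨ cong (eval p y +_) (eval-·ₚ (- 1ℚ) r y) ⟩
    eval p y + (- 1ℚ) * eval r y    ≡⟨ minus-one (eval p y) (eval r y) ⟩
    eval p y - eval r y             ∎
    where
    minus-one : ∀ u v → u + (- 1ℚ) * v ≡ u - v
    minus-one = solve-∀ ℚ-ring
  root : ∀ m → 0 ≤ m → eval d (↑ m) ≡ 0ℚ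
  root m _ = trans (eval-difference (↑ m)) (trans (cong (_- eval r (↑ m)) (agree m)) (+-inverseʳ (eval r (↑ m))))

-- Rising factorials

rising : ℚ → ℕ → ℚ
rising s zero    = 1ℚ
rising s (suc n) = s * rising (s + 1ℚ) n

rising-suc : ∀ s n → rising s (suc n) ≡ rising s n * (s + ↑ n)
rising-suc s zero    = unit s
  where
  unit : ∀ s → s * 1ℚ ≡ 1ℚ * (s + 0ℚ)
  unit = solve-∀ ℚ-ring
rising-suc s (suc n) = begin
  s * rising (s + 1ℚ) (suc n)              ≡⟨ cong (s *_) (rising-suc (s + 1ℚ) n) ⟩
  s * (rising (s + 1ℚ) n * (s + 1ℚ + ↑ n)) ≡⟨ reassociate s (rising (s + 1ℚ) n) (↑ n) ⟩
  s * rising (s + 1ℚ) n * (s + (1ℚ + ↑ n)) ≡⟨ cong (λ t → s * rising (s + 1ℚ) n * (s + t)) (↑-suc n) ⟨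
  s * rising (s + 1ℚ) n * (s + ↑ suc n)    ∎
  where
  reassociate : ∀ s R k → s * (R * (s + 1ℚ + k)) ≡ s * R * (s + (1ℚ + k))
  reassociate = solve-∀ ℚ-ring

rising-difference : ∀ n t → ↑ suc n * rising t n ≡ rising t (suc n) - rising (t - 1ℚ) (suc n)
rising-difference n t = begin
  ↑ suc n * R                                       ≡⟨ cong (_* R) (↑-suc n) ⟩
  (1ℚ + ↑ n) * R                                    ≡⟨ expand t (↑ n) R ⟩
  R * (t + ↑ n) - (t - 1ℚ) * R                      ≡⟨ cong (λ u → R * (t + ↑ n) - (t - 1ℚ) * rising u n) (cancel t) ⟨
  R * (t + ↑ n) - (t - 1ℚ) * rising (t - 1ℚ + 1ℚ) n ≡⟨ cong (_- rising (t - 1ℚ) (suc n)) (rising-suc t n) ⟨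
  rising t (suc n) - rising (t - 1ℚ) (suc n)        ∎
  where
  R = rising t n
  expand : ∀ t k R → (1ℚ + k) * R ≡ R * (t + k) - (t - 1ℚ) * R
  expand = solve-∀ ℚ-ring
  cancel : ∀ t → t - 1ℚ + 1ℚ ≡ t
  cancel = solve-∀ ℚ-ring

rising-root : ∀ {s} n j → j < n → s + ↑ j ≡ 0ℚ → rising s n ≡ 0ℚ
rising-root {s} (suc n) zero    _         s+0≡0 = begin
  s * rising (s + 1ℚ) n  ≡⟨ cong (_* rising (s + 1ℚ) n) (trans (sym (+-identityʳ s)) s+0≡0) ⟩
  0ℚ * rising (s + 1ℚ) n ≡⟨ *-zeroˡ (rising (s + 1ℚ) n) ⟩
  0ℚ                     ∎
rising-root {s} (suc n) (suc j) (s≤s j<n) s+[1+j]≡0 = begin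
  s * rising (s + 1ℚ) n  ≡⟨ cong (s *_) (rising-root n j j<n s+1+j≡0) ⟩
  s * 0ℚ                 ≡⟨ *-zeroʳ s ⟩
  0ℚ                     ∎
  where
  shift : ∀ s k → s + 1ℚ + k ≡ s + (1ℚ + k)
  shift = solve-∀ ℚ-ring
  s+1+j≡0 : s + 1ℚ + ↑ j ≡ 0ℚ
  s+1+j≡0 = trans (shift s (↑ j)) (trans (cong (s +_) (sym (↑-suc j))) s+[1+j]≡0)

rising-neg : ∀ n s → rising (- s) n ≡ signℚ n * rising (s + 1ℚ - ↑ n) n
rising-neg zero    s = refl
rising-neg (suc n) s = begin
  - s * rising (- s + 1ℚ) n                      ≡⟨ cong (λ u → - s * rising u n) (negate s) ⟩
  - s * rising (- (s - 1ℚ)) n                    ≡⟨ cong (- s *_) (rising-neg n (s - 1ℚ)) ⟩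
  - s * (signℚ n * rising (s - 1ℚ + 1ℚ - ↑ n) n) ≡⟨ cong (λ u → - s * (signℚ n * rising u n)) (cancel s (↑ n)) ⟩
  - s * (signℚ n * rising t n)                   ≡⟨ regroup s (↑ n) (signℚ n) (rising t n) ⟩
  - signℚ n * (rising t n * (t + ↑ n))           ≡⟨ cong (- signℚ n *_) (rising-suc t n) ⟨
  - signℚ n * rising t (suc n)                   ≡⟨ cong (λ u → - signℚ n * rising u (suc n)) t≡s+1-[n+1] ⟨
  - signℚ n * rising (s + 1ℚ - ↑ suc n) (suc n)  ∎
  where
  t = s - ↑ n
  t≡s+1-[n+1] : s + 1ℚ - ↑ suc n ≡ t
  t≡s+1-[n+1] = trans (cong (λ u → s + 1ℚ - u) (↑-suc n)) (shift s (↑ n))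
    where
    shift : ∀ s k → s + 1ℚ - (1ℚ + k) ≡ s - k
    shift = solve-∀ ℚ-ring
  negate : ∀ s → - s + 1ℚ ≡ - (s - 1ℚ)
  negate = solve-∀ ℚ-ring
  cancel : ∀ s k → s - 1ℚ + 1ℚ - k ≡ s - k
  cancel = solve-∀ ℚ-ring
  regroup : ∀ s k g R → - s * (g * R) ≡ - g * (R * (s - k + k))
  regroup = solve-∀ ℚ-ring

rising-complement : ∀ n x k k̄ → k̄ ℕ.+ k ≡ n ∸ 1 → rising (- x - ↑ k) n ≡ signℚ n * rising (x - ↑ k̄) n
rising-complement zero    x k k̄ _      = refl
rising-complement (suc n) x k k̄ k̄+k≡n = begin
  rising (- x - ↑ k) (suc n)                              ≡⟨ cong (λ u → rising u (suc n)) (negate x (↑ k)) ⟩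
  rising (- (x + ↑ k)) (suc n)                            ≡⟨ rising-neg (suc n) (x + ↑ k) ⟩
  signℚ (suc n) * rising (x + ↑ k + 1ℚ - ↑ suc n) (suc n) ≡⟨ cong (λ u → signℚ (suc n) * rising u (suc n)) argument ⟩
  signℚ (suc n) * rising (x - ↑ k̄) (suc n)                ∎
  where
  negate : ∀ x k → - x - k ≡ - (x + k)
  negate = solve-∀ ℚ-ring
  cancel : ∀ x k k̄ → x + k + 1ℚ - (1ℚ + (k̄ + k)) ≡ x - k̄
  cancel = solve-∀ ℚ-ring
  argument : x + ↑ k + 1ℚ - ↑ suc n ≡ x - ↑ k̄
  argument = begin
    x + ↑ k + 1ℚ - ↑ suc n               ≡⟨ cong (λ u → x + ↑ k + 1ℚ - u) (↑-suc n) ⟩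
    x + ↑ k + 1ℚ - (1ℚ + ↑ n)            ≡⟨ cong (λ u → x + ↑ k + 1ℚ - (1ℚ + ↑ u)) k̄+k≡n ⟨
    x + ↑ k + 1ℚ - (1ℚ + ↑ (k̄ ℕ.+ k))    ≡⟨ cong (λ u → x + ↑ k + 1ℚ - (1ℚ + u)) (↑-homo-+ k̄ k) ⟩
    x + ↑ k + 1ℚ - (1ℚ + (↑ k̄ + ↑ k))    ≡⟨ cancel x (↑ k) (↑ k̄) ⟩
    x - ↑ k̄                              ∎

risingPoly : ℕ → ℚ → Poly
risingPoly zero    c = 1ℚ ∷ []
risingPoly (suc n) c = (0ℚ ∷ P) +ₚ c ·ₚ P
  where P = risingPoly n (c + 1ℚ)

eval-risingPoly : ∀ n c x → eval (risingPoly n c) x ≡ rising (x + c) n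
eval-risingPoly zero    c x = unit x
  where
  unit : ∀ x → 1ℚ + x * 0ℚ ≡ 1ℚ
  unit = solve-∀ ℚ-ring
eval-risingPoly (suc n) c x = begin
  eval ((0ℚ ∷ P) +ₚ c ·ₚ P) x           ≡⟨ eval-+ₚ (0ℚ ∷ P) (c ·ₚ P) x ⟩
  (0ℚ + x * eval P x) + eval (c ·ₚ P) x ≡⟨ cong ((0ℚ + x * eval P x) +_) (eval-·ₚ c P x) ⟩
  (0ℚ + x * eval P x) + c * eval P x    ≡⟨ factor x c (eval P x) ⟩
  (x + c) * eval P x                    ≡⟨ cong ((x + c) *_) (eval-risingPoly n (c + 1ℚ) x) ⟩
  (x + c) * rising (x + (c + 1ℚ)) n     ≡⟨ cong (λ u → (x + c) * rising u n) (reassociate x c) ⟩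
  (x + c) * rising (x + c + 1ℚ) n       ∎
  where
  P = risingPoly n (c + 1ℚ)
  factor : ∀ x c u → (0ℚ + x * u) + c * u ≡ (x + c) * u
  factor = solve-∀ ℚ-ring
  reassociate : ∀ x c → x + (c + 1ℚ) ≡ x + c + 1ℚ
  reassociate = solve-∀ ℚ-ring

-- Counting admissible sequences

bit : Bool → ℕ
bit b = if b then 1 else 0

size : List Bool → ℕ
size = count id

bit+<⇒≤ : ∀ b {x m} → x < m → bit b ℕ.+ x ≤ m
bit+<⇒≤ true  x<m = x<m
bit+<⇒≤ false x<m = ℕ.<⇒≤ x<m

count-cong : ∀ {A : Set} {p q : A → Bool} → (∀ a → p a ≡ q a) → ∀ l → count p l ≡ count q l
count-cong p≗q []      = refl
count-cong p≗q (a ∷ l) = cong₂ (λ b n → bit b ℕ.+ n) (p≗q a) (count-cong p≗q l)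

count-++ : ∀ {A : Set} (p : A → Bool) xs ys → count p (xs ++ ys) ≡ count p xs ℕ.+ count p ys
count-++ p []       ys = refl
count-++ p (x ∷ xs) ys = trans (cong (bit (p x) ℕ.+_) (count-++ p xs ys)) (sym (ℕ.+-assoc (bit (p x)) _ _))

count-tabulate : ∀ {A : Set} {m} (p : A → Bool) (f : Fin m → A) → count p (tabulate f) ≡ ℕΣ.∑[ i < m ] bit (p (f i))
count-tabulate {m = zero}  p f = refl
count-tabulate {m = suc m} p f = cong (bit (p (f Fin.zero)) ℕ.+_) (count-tabulate p (f ∘ Fin.suc))

count-const-∧ : ∀ {A : Set} c (p : A → Bool) l → count (λ a → c ∧ p a) l ≡ (if c then count p l else 0)
count-const-∧ true  p l       = refl
count-const-∧ false p []      = refl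
count-const-∧ false p (a ∷ l) = count-const-∧ false p l

count≤length : ∀ {A : Set} (p : A → Bool) l → count p l ≤ length l
count≤length p []      = z≤n
count≤length p (a ∷ l) with p a
... | true  = s≤s (count≤length p l)
... | false = ℕ.m≤n⇒m≤1+n (count≤length p l)

count-allVecs-suc : ∀ {m n} (p : Vec (Fin m) (suc n) → Bool) →
  count p (allVecs m (suc n)) ≡ ℕΣ.∑[ i < m ] count (p ∘ (i ∷_)) (allVecs m n)
count-allVecs-suc {m} {n} p = go (allVecs m n)
  where
  go : ∀ vs → count p (concatMap (λ v → map (_∷ v) (allFin m)) vs) ≡ ℕΣ.∑[ i < m ] count (p ∘ (i ∷_)) vs
  go []       = sym (ℕΣ.sum-replicate-zero m)
  go (v ∷ vs) = begin
    count p (map (_∷ v) (allFin m) ++ rest)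
      ≡⟨ count-++ p (map (_∷ v) (allFin m)) rest ⟩
    count p (map (_∷ v) (allFin m)) ℕ.+ count p rest
      ≡⟨ cong₂ ℕ._+_ first-entries (go vs) ⟩
    ℕΣ.∑[ i < m ] bit (p (i ∷ v)) ℕ.+ ℕΣ.∑[ i < m ] count (p ∘ (i ∷_)) vs
      ≡⟨ ℕΣ.∑-distrib-+ (λ i → bit (p (i ∷ v))) (λ i → count (p ∘ (i ∷_)) vs) ⟨
    ℕΣ.∑[ i < m ] count (p ∘ (i ∷_)) (v ∷ vs)
      ∎
    where
    rest = concatMap (λ v → map (_∷ v) (allFin m)) vs
    first-entries : count p (map (_∷ v) (allFin m)) ≡ ℕΣ.∑[ i < m ] bit (p (i ∷ v))
    first-entries = trans (cong (count p) (map-tabulate id (_∷ v))) (count-tabulate p (_∷ v))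

toℕs : ∀ {m n} → Vec (Fin m) n → List ℕ
toℕs v = map toℕ (toList v)

-- Prepending lo with a weak step adds exactly the constraint lo ≤ s₁ to the admissibility of s.
countFrom : ℕ → List Bool → ℕ → ℕ → ℕ
countFrom n I m lo = count (λ v → admissible (false ∷ I) (lo ∷ toℕs v)) (allVecs m n)

Fone≡countFrom-0 : ∀ n I m → Fone n I m ≡ countFrom n I m 0
Fone≡countFrom-0 n I m = count-cong (λ v → admissible-from-0 I (toℕs v)) (allVecs m n)
  where
  admissible-from-0 : ∀ I s → admissible I s ≡ admissible (false ∷ I) (0 ∷ s)
  admissible-from-0 []      []      = refl
  admissible-from-0 (b ∷ I) []      = refl
  admissible-from-0 I       (x ∷ s) = refl

admissible-shift : ∀ b I x s → admissible (b ∷ I) (x ∷ s) ≡ admissible (false ∷ I) (bit b ℕ.+ x ∷ s)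
admissible-shift false I x s       = refl
admissible-shift true  I x []      = refl
admissible-shift true  I x (y ∷ s) = refl

countFrom-suc : ∀ n b I m lo →
  countFrom (suc n) (b ∷ I) m lo ≡ ℕΣ.∑[ i < m ] (if lo ≤ᵇ toℕ i then countFrom n I m (bit b ℕ.+ toℕ i) else 0)
countFrom-suc n b I m lo = begin
  count P (allVecs m (suc n))                    ≡⟨ count-allVecs-suc P ⟩
  ℕΣ.∑[ i < m ] count (P ∘ (i ∷_)) (allVecs m n) ≡⟨ ℕΣ.sum-cong-≗ {m} first-entry ⟩
  ℕΣ.∑[ i < m ] (if lo ≤ᵇ toℕ i then countFrom n I m (bit b ℕ.+ toℕ i) else 0) ∎
  where
  P : Vec (Fin m) (suc n) → Bool
  P v = admissible (false ∷ b ∷ I) (lo ∷ toℕs v)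
  first-entry : ∀ i → count (P ∘ (i ∷_)) (allVecs m n) ≡ (if lo ≤ᵇ toℕ i then countFrom n I m (bit b ℕ.+ toℕ i) else 0)
  first-entry i = trans
    (count-cong (λ v → cong ((lo ≤ᵇ toℕ i) ∧_) (admissible-shift b I (toℕ i) (toℕs v))) (allVecs m n))
    (count-const-∧ (lo ≤ᵇ toℕ i) (λ v → admissible (false ∷ I) (bit b ℕ.+ toℕ i ∷ toℕs v)) (allVecs m n))

countFrom-1-[] : ∀ m lo → countFrom 1 [] m lo ≡ countFrom 1 (false ∷ []) m lo
countFrom-1-[] m lo = count-cong (λ { (x ∷ []) → refl }) (allVecs m 1)

countFrom-step : ∀ n b I → size (b ∷ I) ≤ n →
  (∀ {m y} → y ≤ m → ↑ (n !) * ↑ countFrom n I m y ≡ rising (↑ m - ↑ (y ℕ.+ size I)) n) →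
  ∀ {m lo} → lo ≤ m →
  ↑ (suc n !) * ↑ countFrom (suc n) (b ∷ I) m lo ≡ rising (↑ m - ↑ (lo ℕ.+ size (b ∷ I))) (suc n)
countFrom-step n b I s≤n closed {m} {lo} lo≤m = begin
  ↑ (suc n !) * ↑ countFrom (suc n) (b ∷ I) m lo
    ≡⟨ cong (λ k → ↑ (suc n !) * ↑ k) (countFrom-suc n b I m lo) ⟩
  ↑ (suc n !) * ↑ ℕΣ.sum h
    ≡⟨ cong (↑ (suc n !) *_) (↑-∑ h) ⟩
  ↑ (suc n !) * ∑[ i < m ] (↑ h i)
    ≡⟨ *-distribˡ-sum (↑ (suc n !)) (λ i → ↑ h i) ⟩
  ∑[ i < m ] (↑ (suc n !) * ↑ h i)
    ≡⟨ sum-cong-≗ {m} (λ i → difference i (lo ≤ᵇ toℕ i)) ⟩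
  ∑[ i < m ] (if lo ≤ᵇ toℕ i then G (toℕ i) - G (suc (toℕ i)) else 0ℚ)
    ≡⟨ telescope G lo≤m ⟩
  G lo - G m
    ≡⟨ cong (λ u → G lo - u) G-m≡0 ⟩
  G lo - 0ℚ
    ≡⟨ +-identityʳ (G lo) ⟩
  G lo
    ∎
  where
  s = size (b ∷ I)
  h : Fin m → ℕ
  h i = if lo ≤ᵇ toℕ i then countFrom n I m (bit b ℕ.+ toℕ i) else 0
  G : ℕ → ℚ
  G y = rising (↑ m - ↑ (y ℕ.+ s)) (suc n)
  G-m≡0 : G m ≡ 0ℚ
  G-m≡0 = rising-root {↑ m - ↑ (m ℕ.+ s)} (suc n) s (s≤s s≤n) (begin
    ↑ m - ↑ (m ℕ.+ s) + ↑ s ≡⟨ cong (λ u → ↑ m - u + ↑ s) (↑-homo-+ m s) ⟩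
    ↑ m - (↑ m + ↑ s) + ↑ s ≡⟨ cancel (↑ m) (↑ s) ⟩
    0ℚ                      ∎)
    where
    cancel : ∀ a b → a - (a + b) + b ≡ 0ℚ
    cancel = solve-∀ ℚ-ring
  difference : ∀ i β → ↑ (suc n !) * ↑ (if β then countFrom n I m (bit b ℕ.+ toℕ i) else 0)
                      ≡ (if β then G (toℕ i) - G (suc (toℕ i)) else 0ℚ)
  difference i false = *-zeroʳ (↑ (suc n !))
  difference i true  = begin
    ↑ (suc n !) * ↑ c                               ≡⟨ cong (_* ↑ c) (↑-homo-* (suc n) (n !)) ⟩
    ↑ suc n * ↑ (n !) * ↑ c                         ≡⟨ *-assoc (↑ suc n) (↑ (n !)) (↑ c) ⟩
    ↑ suc n * (↑ (n !) * ↑ c)                       ≡⟨ cong (↑ suc n *_) (closed (bit+<⇒≤ b (toℕ<n i))) ⟩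
    ↑ suc n * rising (↑ m - ↑ (y ℕ.+ size I)) n     ≡⟨ cong (λ k → ↑ suc n * rising (↑ m - ↑ k) n) reorder ⟩
    ↑ suc n * rising (↑ m - ↑ (x ℕ.+ s)) n          ≡⟨ rising-difference n (↑ m - ↑ (x ℕ.+ s)) ⟩
    G x - rising (↑ m - ↑ (x ℕ.+ s) - 1ℚ) (suc n)   ≡⟨ cong (λ u → G x - rising u (suc n)) next ⟩
    G x - G (suc x)                                 ∎
    where
    x = toℕ i
    y = bit b ℕ.+ x
    c = countFrom n I m y
    reorder : y ℕ.+ size I ≡ x ℕ.+ s
    reorder = trans (cong (ℕ._+ size I) (ℕ.+-comm (bit b) x)) (ℕ.+-assoc x (bit b) (size I))
    step : ∀ a y → a - y - 1ℚ ≡ a - (1ℚ + y)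
    step = solve-∀ ℚ-ring
    next : ↑ m - ↑ (x ℕ.+ s) - 1ℚ ≡ ↑ m - ↑ (suc x ℕ.+ s)
    next = trans (step (↑ m) (↑ (x ℕ.+ s))) (cong (λ u → ↑ m - u) (sym (↑-suc (x ℕ.+ s))))

countFrom-closed : ∀ I {m lo} → lo ≤ m →
  ↑ (suc (length I) !) * ↑ countFrom (suc (length I)) I m lo ≡ rising (↑ m - ↑ (lo ℕ.+ size I)) (suc (length I))
countFrom-closed []      {m} {lo} lo≤m =
  trans (cong (λ k → ↑ 1 * ↑ k) (countFrom-1-[] m lo)) (countFrom-step 0 false [] z≤n (λ _ → refl) lo≤m)
countFrom-closed (b ∷ I) = countFrom-step (suc (length I)) b I (count≤length id (b ∷ I)) (countFrom-closed I)

-- Descents of listings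

length-XDes : ∀ {n} (E : Digraph n) σ → length (XDes E σ) ≡ n ∸ 1
length-XDes {n} E σ = trans (length-desList (toList σ)) (cong (_∸ 1) (length-toList σ))
  where
  length-desList : ∀ l → length (desList E l) ≡ length l ∸ 1
  length-desList []          = refl
  length-desList (x ∷ [])    = refl
  length-desList (x ∷ y ∷ l) = cong suc (length-desList (y ∷ l))

n!·Fone-XDes : ∀ {n} (E : Digraph n) σ m → ↑ (n !) * ↑ Fone n (XDes E σ) m ≡ rising (↑ m - ↑ size (XDes E σ)) n
n!·Fone-XDes {zero}  E [] m = refl
n!·Fone-XDes {suc n} E σ  m = begin
  ↑ (suc n !) * ↑ Fone (suc n) I m        ≡⟨ cong (λ k → ↑ (suc n !) * ↑ k) (Fone≡countFrom-0 (suc n) I m) ⟩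
  ↑ (suc n !) * ↑ countFrom (suc n) I m 0 ≡⟨ subst closed-form (length-XDes E σ) (countFrom-closed I z≤n) ⟩
  rising (↑ m - ↑ size I) (suc n)         ∎
  where
  I = XDes E σ
  closed-form : ℕ → Set
  closed-form k = ↑ (suc k !) * ↑ countFrom (suc k) I m 0 ≡ rising (↑ m - ↑ size I) (suc k)

desList-complement : ∀ {n} (E : Digraph n) l → distinct l ≡ true → desList (complement E) l ≡ map not (desList E l)
desList-complement E []          _ = refl
desList-complement E (x ∷ [])    _ = refl
desList-complement E (x ∷ y ∷ l) h =
  cong₂ _∷_ first (desList-complement E (y ∷ l) (∧-conicalʳ x-fresh (distinct (y ∷ l)) h))
  where
  x-fresh = not (any (λ z → toℕ x ℕ.≡ᵇ toℕ z) (y ∷ l))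
  x≢y : (toℕ x ℕ.≡ᵇ toℕ y) ≡ false
  x≢y = ∨-conicalˡ _ (any (λ z → toℕ x ℕ.≡ᵇ toℕ z) l) (not-injective (∧-conicalˡ x-fresh (distinct (y ∷ l)) h))
  first : complement E x y ≡ not (E x y)
  first = cong (if_then false else not (E x y)) x≢y

size-map-not : ∀ I → size (map not I) ℕ.+ size I ≡ length I
size-map-not []          = refl
size-map-not (true ∷ I)  = trans (ℕ.+-suc (size (map not I)) (size I)) (cong suc (size-map-not I))
size-map-not (false ∷ I) = cong suc (size-map-not I)

-- The Redei–Berge polynomial

listingTerm : ∀ {n} → Digraph n → ℚ → Vec (Fin n) n → ℚ
listingTerm {n} E x σ = if isListing σ then rising (x - ↑ size (XDes E σ)) n else 0ℚ

scaledU : ∀ {n} → Digraph n → ℚ → ℚ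
scaledU {n} E x = ∑[ σ ∈ allVecs n n ] listingTerm E x σ

scaledUPoly : ∀ {n} → Digraph n → Poly
scaledUPoly {n} E = ∑ₚ[ σ ∈ allVecs n n ] (if isListing σ then risingPoly n (- ↑ size (XDes E σ)) else [])

eval-scaledUPoly : ∀ {n} (E : Digraph n) x → eval (scaledUPoly E) x ≡ scaledU E x
eval-scaledUPoly {n} E x =
  trans (eval-sumₚ _ (allVecs n n) x) (sumOver-cong (λ σ → term σ (isListing σ)) (allVecs n n))
  where
  term : ∀ σ β → eval (if β then risingPoly n (- ↑ size (XDes E σ)) else []) x
               ≡ (if β then rising (x - ↑ size (XDes E σ)) n else 0ℚ)
  term σ true  = eval-risingPoly n (- ↑ size (XDes E σ)) x
  term σ false = refl

n!·uX≡scaledU : ∀ {n} (E : Digraph n) m → ↑ (n !) * ↑ uX E m ≡ scaledU E (↑ m)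
n!·uX≡scaledU {n} E m = begin
  ↑ (n !) * ↑ sumℕ (map f (allVecs n n))   ≡⟨ cong (↑ (n !) *_) (↑-sumℕ f (allVecs n n)) ⟩
  ↑ (n !) * (∑[ σ ∈ allVecs n n ] ↑ f σ)   ≡⟨ *-distribˡ-sumOver (↑ (n !)) (↑_ ∘ f) (allVecs n n) ⟩
  ∑[ σ ∈ allVecs n n ] ↑ (n !) * ↑ f σ     ≡⟨ sumOver-cong (λ σ → term σ (isListing σ)) (allVecs n n) ⟩
  scaledU E (↑ m)                          ∎
  where
  f : Vec (Fin n) n → ℕ
  f σ = if isListing σ then Fone n (XDes E σ) m else 0
  term : ∀ σ β → ↑ (n !) * ↑ (if β then Fone n (XDes E σ) m else 0)
               ≡ (if β then rising (↑ m - ↑ size (XDes E σ)) n else 0ℚ)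
  term σ true  = n!·Fone-XDes E σ m
  term σ false = *-zeroʳ (↑ (n !))

n!·eval≡scaledU : ∀ {n} (E : Digraph n) p → Represents p E → ∀ x → ↑ (n !) * eval p x ≡ scaledU E x
n!·eval≡scaledU {n} E p represents x = begin
  ↑ (n !) * eval p x     ≡⟨ eval-·ₚ (↑ (n !)) p x ⟨
  eval (↑ (n !) ·ₚ p) x  ≡⟨ agree-on-ℕ⇒agree (↑ (n !) ·ₚ p) (scaledUPoly E) agree x ⟩
  eval (scaledUPoly E) x ≡⟨ eval-scaledUPoly E x ⟩
  scaledU E x            ∎
  where
  agree : ∀ m → eval (↑ (n !) ·ₚ p) (↑ m) ≡ eval (scaledUPoly E) (↑ m)
  agree m = begin
    eval (↑ (n !) ·ₚ p) (↑ m)  ≡⟨ eval-·ₚ (↑ (n !)) p (↑ m) ⟩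
    ↑ (n !) * eval p (↑ m)     ≡⟨ cong (↑ (n !) *_) (represents m) ⟩
    ↑ (n !) * ↑ uX E m         ≡⟨ n!·uX≡scaledU E m ⟩
    scaledU E (↑ m)            ≡⟨ eval-scaledUPoly E (↑ m) ⟨
    eval (scaledUPoly E) (↑ m) ∎

scaledU-reciprocity : ∀ {n} (E : Digraph n) x → scaledU E (- x) ≡ signℚ n * scaledU (complement E) x
scaledU-reciprocity {n} E x = begin
  scaledU E (- x)
    ≡⟨ sumOver-cong (λ σ → term σ (isListing σ) refl) (allVecs n n) ⟩
  ∑[ σ ∈ allVecs n n ] signℚ n * listingTerm (complement E) x σ
    ≡⟨ *-distribˡ-sumOver (signℚ n) (listingTerm (complement E) x) (allVecs n n) ⟨
  signℚ n * scaledU (complement E) x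
    ∎
  where
  term : ∀ σ β → isListing σ ≡ β →
         (if β then rising (- x - ↑ size (XDes E σ)) n else 0ℚ)
         ≡ signℚ n * (if β then rising (x - ↑ size (XDes (complement E) σ)) n else 0ℚ)
  term σ false _       = sym (*-zeroʳ (signℚ n))
  term σ true  listing = rising-complement n x k k̄ (begin
    k̄ ℕ.+ k                         ≡⟨ cong (λ I → size I ℕ.+ k) (desList-complement E (toList σ) listing) ⟩
    size (map not (XDes E σ)) ℕ.+ k ≡⟨ size-map-not (XDes E σ) ⟩
    length (XDes E σ)               ≡⟨ length-XDes E σ ⟩
    n ∸ 1                           ∎)
    where
    k = size (XDes E σ)
    k̄ = size (XDes (complement E) σ)

mainTheorem9 : (n : ℕ) (E : Digraph n) → Loopless E →
    (p q : Poly) → Represents p E → Represents q (complement E) →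
    (x : ℚ) → eval p (- x) ≡ signℚ n * eval q x
mainTheorem9 n E _ p q represents-p represents-q x = *-cancelˡ-≡ (↑ (n !)) (↑n!≢0 n) (begin
  ↑ (n !) * eval p (- x)             ≡⟨ n!·eval≡scaledU E p represents-p (- x) ⟩
  scaledU E (- x)                    ≡⟨ scaledU-reciprocity E x ⟩
  signℚ n * scaledU (complement E) x ≡⟨ cong (signℚ n *_) (n!·eval≡scaledU (complement E) q represents-q x) ⟨
  signℚ n * (↑ (n !) * eval q x)     ≡⟨ swap (signℚ n) (↑ (n !)) (eval q x) ⟩
  ↑ (n !) * (signℚ n * eval q x)     ∎)
  where
  swap : ∀ a b c → a * (b * c) ≡ b * (a * c)
  swap = solve-∀ ℚ-ring
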